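{- Let $X\subseteq B^h$, $G=Q_h(X)$, and let $u\in V(G)$ have degree $h$. Let $X'=\{x\in\widehat X: u\in I_G(0^h,x)\}$ and $G^u=G[\bigcup_{x\in X'}I_G(0^h,x)]$. Then $N(u)\subseteq V(G^u)$.
   Context: $B=\{0,1\}$, $B^h$ binary words of length $h$, $Q_h$ the hypercube on $B^h$ (adjacent iff Hamming distance $1$). $u\le v$ means $u_i\le v_i$ for all $i$. For $X\subseteq B^h$, $\widehat X$ is the set of maximal elements of $(X,\le)$ and the daisy cube $Q_h(X)$ is the subgraph of $Q_h$ induced by $\{v: v\le x\text{ for some }x\in X\}$. $I_G(a,b)$ is the set of vertices on shortest $a,b$-paths in $G$; $G[A]$ is the induced subgraph on $A$; $N(u)$ is the set of neighbours of $u$. -}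

module Defs where

open import Data.Bool using (Bool; true; false)
import Data.Bool as B
import Data.Bool.Properties as BP
open import Data.Nat using (ℕ; zero; suc; _≤_; _≟_)
open import Data.Vec using (Vec; []; _∷_; replicate)
open import Data.List using (List; []; _∷_; map; _++_; filter; length)
open import Data.List.Relation.Unary.Any using (Any; any?)
open import Data.List.Membership.Propositional using (_∈_)
open import Data.Product using (Σ; ∃; _×_; _,_)
open import Relation.Nullary using (Dec; _×-dec_)
open import Relation.Binary.PropositionalEquality using (_≡_)
import Data.Vec.Relation.Binary.Pointwise.Inductive as PW

Word : ℕ → Set
Word h = Vec Bool h

0ʰ : (h : ℕ) → Word h
0ʰ h = replicate h false

_≤ʷ_ : ∀ {h} → Word h → Word h → Set
_≤ʷ_ = PW.Pointwise B._≤_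

_≤ʷ?_ : ∀ {h} (u v : Word h) → Dec (u ≤ʷ v)
_≤ʷ?_ = PW.decidable BP._≤?_

hamming : ∀ {h} → Word h → Word h → ℕ
hamming [] [] = 0
hamming (a ∷ u) (b ∷ v) with a B.≟ b
... | Relation.Nullary.yes _ = hamming u v
... | Relation.Nullary.no _ = suc (hamming u v)

Adj : ∀ {h} → Word h → Word h → Set
Adj u v = hamming u v ≡ 1

Adj? : ∀ {h} (u v : Word h) → Dec (Adj u v)
Adj? u v = hamming u v ≟ 1

allWords : (h : ℕ) → List (Word h)
allWords zero = [] ∷ []
allWords (suc h) = map (false ∷_) (allWords h) ++ map (true ∷_) (allWords h)

-- X ⊆ B^h is given as a finite list; vertex set of the daisy cube Q_h(X)
InG : ∀ {h} → List (Word h) → Word h → Set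
InG X v = Any (v ≤ʷ_) X

InG? : ∀ {h} (X : List (Word h)) (v : Word h) → Dec (InG X v)
InG? X v = any? (v ≤ʷ?_) X

degree : ∀ {h} → List (Word h) → Word h → ℕ
degree {h} X u = length (filter (λ v → InG? X v ×-dec Adj? u v) (allWords h))

data Walk {h} (X : List (Word h)) : Word h → Word h → ℕ → Set where
  stop : ∀ {a} → InG X a → Walk X a a 0
  step : ∀ {a b c n} → InG X a → Adj a b → Walk X b c n → Walk X a c (suc n)

data OnWalk {h} {X : List (Word h)} (v : Word h) : ∀ {a b n} → Walk X a b n → Set where
  on-stop : (p : InG X v) → OnWalk v (stop p)
  on-here : ∀ {b c n} (p : InG X v) (q : Adj v b) (w : Walk X b c n) → OnWalk v (step p q w)
  on-there : ∀ {a b c n} (p : InG X a) (q : Adj a b) (w : Walk X b c n) → OnWalk v w → OnWalk v (step p q w)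

IsShortest : ∀ {h} {X : List (Word h)} {a b n} → Walk X a b n → Set
IsShortest {X = X} {a} {b} {n} _ = ∀ m → Walk X a b m → n ≤ m

Interval : ∀ {h} → List (Word h) → Word h → Word h → Word h → Set
Interval X a b v = Σ ℕ λ n → Σ (Walk X a b n) λ w → IsShortest w × OnWalk v w

Maximal : ∀ {h} → List (Word h) → Word h → Set
Maximal X x = x ∈ X × (∀ y → y ∈ X → x ≤ʷ y → y ≡ x)

InX' : ∀ {h} → List (Word h) → Word h → Word h → Set
InX' {h} X u x = Maximal X x × Interval X (0ʰ h) x u

InGu : ∀ {h} → List (Word h) → Word h → Word h → Set
InGu {h} X u v = ∃ λ x → InX' X u x × Interval X (0ʰ h) x v

-- Adjacent words are comparable, so the larger of u and v lies below some maximal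
-- element x of X. Every z ≤ x lies on a monotone 0ʰ,x-path of length weight x, and
-- such a path is geodesic in G because one step changes the weight by at most one.
-- Hence u and v both lie in I_G(0ʰ, x), so x ∈ X'.
module Submission where

open import Defs
open import Data.Bool using (Bool; true; false)
import Data.Bool as B
import Data.Bool.Properties as BP
open import Data.Nat using (ℕ; zero; suc; _+_; _≤_; _<_; z≤n; s≤s)
open import Data.Nat.Properties
  using (≤-trans; n≤1+n; m≤n⇒m≤1+n; m≤m+n; m≤n+m; +-suc; +-identityʳ; +-assoc; +-monoˡ-≤; +-monoʳ-≤; <⇒≱; suc-injective; module ≤-Reasoning)
open import Data.Vec using ([]; _∷_)
open import Data.Vec.Properties using (≡-dec)
import Data.Vec.Relation.Binary.Pointwise.Inductive as PW
open import Data.List using (List)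
import Data.List.Relation.Unary.Any as Any
open import Data.List.Membership.Propositional using (_∈_; find; lose)
open import Data.Product using (∃; _×_; _,_)
open import Data.Sum using (_⊎_; inj₁; inj₂)
open import Data.Empty using (⊥-elim)
open import Relation.Binary.Definitions using (DecidableEquality)
open import Relation.Nullary using (yes; no; ¬?; _×-dec_)
open import Relation.Binary.PropositionalEquality using (_≡_; _≢_; refl; sym; trans; cong; subst; module ≡-Reasoning)

≤ʷ-refl : ∀ {h} {v : Word h} → v ≤ʷ v
≤ʷ-refl = PW.refl BP.≤-refl

≤ʷ-trans : ∀ {h} {u v w : Word h} → u ≤ʷ v → v ≤ʷ w → u ≤ʷ w
≤ʷ-trans = PW.trans BP.≤-trans

0ʰ≤ʷ : ∀ {h} (v : Word h) → 0ʰ h ≤ʷ v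
0ʰ≤ʷ [] = PW.[]
0ʰ≤ʷ (false ∷ v) = B.b≤b PW.∷ 0ʰ≤ʷ v
0ʰ≤ʷ (true ∷ v) = B.f≤t PW.∷ 0ʰ≤ʷ v

weight : ∀ {h} → Word h → ℕ
weight [] = 0
weight (false ∷ v) = weight v
weight (true ∷ v) = suc (weight v)

weight-0ʰ : ∀ h → weight (0ʰ h) ≡ 0
weight-0ʰ zero = refl
weight-0ʰ (suc h) = weight-0ʰ h

weight≤length : ∀ {h} (v : Word h) → weight v ≤ h
weight≤length [] = z≤n
weight≤length (false ∷ v) = m≤n⇒m≤1+n (weight≤length v)
weight≤length (true ∷ v) = s≤s (weight≤length v)

weight-mono : ∀ {h} {u v : Word h} → u ≤ʷ v → weight u ≤ weight v
weight-mono PW.[] = z≤n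
weight-mono (B.f≤t PW.∷ p) = m≤n⇒m≤1+n (weight-mono p)
weight-mono (B.b≤b {false} PW.∷ p) = weight-mono p
weight-mono (B.b≤b {true} PW.∷ p) = s≤s (weight-mono p)

weight-strictMono : ∀ {h} {u v : Word h} → u ≤ʷ v → v ≢ u → weight u < weight v
weight-strictMono PW.[] v≢u = ⊥-elim (v≢u refl)
weight-strictMono (B.f≤t PW.∷ p) _ = s≤s (weight-mono p)
weight-strictMono (B.b≤b {false} PW.∷ p) v≢u = weight-strictMono p (λ e → v≢u (cong (false ∷_) e))
weight-strictMono (B.b≤b {true} PW.∷ p) v≢u = s≤s (weight-strictMono p (λ e → v≢u (cong (true ∷_) e)))

hamming-self : ∀ {h} (v : Word h) → hamming v v ≡ 0
hamming-self [] = refl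
hamming-self (false ∷ v) = hamming-self v
hamming-self (true ∷ v) = hamming-self v

hamming≡0⇒≡ : ∀ {h} (u v : Word h) → hamming u v ≡ 0 → u ≡ v
hamming≡0⇒≡ [] [] _ = refl
hamming≡0⇒≡ (false ∷ u) (false ∷ v) e = cong (false ∷_) (hamming≡0⇒≡ u v e)
hamming≡0⇒≡ (true ∷ u) (true ∷ v) e = cong (true ∷_) (hamming≡0⇒≡ u v e)
hamming≡0⇒≡ (false ∷ u) (true ∷ v) ()
hamming≡0⇒≡ (true ∷ u) (false ∷ v) ()

weight≤weight+hamming : ∀ {h} (u v : Word h) → weight v ≤ weight u + hamming u v
weight≤weight+hamming [] [] = z≤n
weight≤weight+hamming (false ∷ u) (false ∷ v) = weight≤weight+hamming u v
weight≤weight+hamming (true ∷ u) (true ∷ v) = s≤s (weight≤weight+hamming u v)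
weight≤weight+hamming (false ∷ u) (true ∷ v)
  rewrite +-suc (weight u) (hamming u v) = s≤s (weight≤weight+hamming u v)
weight≤weight+hamming (true ∷ u) (false ∷ v) =
  m≤n⇒m≤1+n (≤-trans (weight≤weight+hamming u v) (+-monoʳ-≤ (weight u) (n≤1+n _)))

Adj⇒comparable : ∀ {h} (u v : Word h) → Adj u v → u ≤ʷ v ⊎ v ≤ʷ u
Adj⇒comparable [] [] ()
Adj⇒comparable (false ∷ u) (false ∷ v) u~v with Adj⇒comparable u v u~v
... | inj₁ u≤v = inj₁ (B.b≤b PW.∷ u≤v)
... | inj₂ v≤u = inj₂ (B.b≤b PW.∷ v≤u)
Adj⇒comparable (true ∷ u) (true ∷ v) u~v with Adj⇒comparable u v u~v
... | inj₁ u≤v = inj₁ (B.b≤b PW.∷ u≤v)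
... | inj₂ v≤u = inj₂ (B.b≤b PW.∷ v≤u)
Adj⇒comparable (false ∷ u) (true ∷ v) u~v with refl ← hamming≡0⇒≡ u v (suc-injective u~v) =
  inj₁ (B.f≤t PW.∷ ≤ʷ-refl)
Adj⇒comparable (true ∷ u) (false ∷ v) u~v with refl ← hamming≡0⇒≡ u v (suc-injective u~v) =
  inj₂ (B.f≤t PW.∷ ≤ʷ-refl)

walk-weight : ∀ {h} {X : List (Word h)} {a b m} → Walk X a b m → weight b ≤ weight a + m
walk-weight {a = a} (stop _) = m≤m+n (weight a) 0
walk-weight {a = a} {b} (step {b = a′} {n = n} _ a~a′ w) = begin
  weight b                     ≤⟨ walk-weight w ⟩
  weight a′ + n                ≤⟨ +-monoˡ-≤ n (weight≤weight+hamming a a′) ⟩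
  weight a + hamming a a′ + n  ≡⟨ cong (λ k → weight a + k + n) a~a′ ⟩
  weight a + 1 + n             ≡⟨ +-assoc (weight a) 1 n ⟩
  weight a + suc n             ∎
  where open ≤-Reasoning

_≟ʷ_ : ∀ {h} → DecidableEquality (Word h)
_≟ʷ_ = ≡-dec B._≟_

-- The fuel n bounds the number of strict ascents still possible in B^h.
maximal-above : ∀ {h} (X : List (Word h)) (n : ℕ) {y : Word h} → y ∈ X → h ≤ weight y + n →
  ∃ λ x → Maximal X x × y ≤ʷ x
maximal-above {h} X n {y} y∈X bound with Any.any? (λ z → (y ≤ʷ? z) ×-dec ¬? (z ≟ʷ y)) X
... | no nothing-above = y , (y∈X , y-max) , ≤ʷ-refl
  where
  y-max : ∀ z → z ∈ X → y ≤ʷ z → z ≡ y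
  y-max z z∈X y≤z with z ≟ʷ y
  ... | yes z≡y = z≡y
  ... | no z≢y = ⊥-elim (nothing-above (lose z∈X (y≤z , z≢y)))
... | yes something-above with z , z∈X , y≤z , z≢y ← find something-above | n
... | zero = ⊥-elim (<⇒≱ (weight-strictMono y≤z z≢y) (begin
  weight z      ≤⟨ weight≤length z ⟩
  h             ≤⟨ bound ⟩
  weight y + 0  ≡⟨ +-identityʳ (weight y) ⟩
  weight y      ∎))
  where open ≤-Reasoning
... | suc m = let x , x-max , z≤x = maximal-above X m z∈X bound′ in x , x-max , ≤ʷ-trans y≤z z≤x
  where
  open ≤-Reasoning
  bound′ : h ≤ weight z + m
  bound′ = begin
    h                   ≤⟨ bound ⟩
    weight y + suc m    ≡⟨ +-suc (weight y) m ⟩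
    suc (weight y) + m  ≤⟨ +-monoˡ-≤ m (weight-strictMono y≤z z≢y) ⟩
    weight z + m        ∎

below-maximal : ∀ {h} (X : List (Word h)) {w : Word h} → InG X w → ∃ λ x → Maximal X x × w ≤ʷ x
below-maximal {h} X wG =
  let y , y∈X , w≤y = find wG
      x , x-max , y≤x = maximal-above X h y∈X (m≤n+m h (weight y))
  in x , x-max , ≤ʷ-trans w≤y y≤x

data Walk≤ {h} (t : Word h) : Word h → Word h → ℕ → Set where
  stop : ∀ {a} → a ≤ʷ t → Walk≤ t a a 0
  step : ∀ {a b c n} → a ≤ʷ t → Adj a b → Walk≤ t b c n → Walk≤ t a c (suc n)

Adj-cons : ∀ {h} (c : Bool) {a b : Word h} → Adj a b → Adj (c ∷ a) (c ∷ b)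
Adj-cons false a~b = a~b
Adj-cons true a~b = a~b

Walk≤-cons : ∀ {h} (c : Bool) {t a b : Word h} {n} → Walk≤ t a b n → Walk≤ (c ∷ t) (c ∷ a) (c ∷ b) n
Walk≤-cons c (stop a≤t) = stop (B.b≤b PW.∷ a≤t)
Walk≤-cons c (step a≤t a~b w) = step (B.b≤b PW.∷ a≤t) (Adj-cons c a~b) (Walk≤-cons c w)

Walk≤-weaken : ∀ {h} {t t′ a b : Word h} {n} → t ≤ʷ t′ → Walk≤ t a b n → Walk≤ t′ a b n
Walk≤-weaken t≤t′ (stop a≤t) = stop (≤ʷ-trans a≤t t≤t′)
Walk≤-weaken t≤t′ (step a≤t a~b w) = step (≤ʷ-trans a≤t t≤t′) a~b (Walk≤-weaken t≤t′ w)

_++≤_ : ∀ {h} {t a b c : Word h} {n m} → Walk≤ t a b n → Walk≤ t b c m → Walk≤ t a c (n + m)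
stop _ ++≤ w = w
step a≤t a~b w ++≤ w′ = step a≤t a~b (w ++≤ w′)

rise : ∀ {h} → Word h → Word h → ℕ
rise [] [] = 0
rise (false ∷ a) (true ∷ b) = suc (rise a b)
rise (_ ∷ a) (_ ∷ b) = rise a b

ascent : ∀ {h} {a b : Word h} → a ≤ʷ b → Walk≤ b a b (rise a b)
ascent PW.[] = stop PW.[]
ascent {a = false ∷ a} (B.f≤t PW.∷ a≤b) =
  step (B.f≤t PW.∷ a≤b) (cong suc (hamming-self a)) (Walk≤-cons true (ascent a≤b))
ascent (B.b≤b {false} PW.∷ a≤b) = Walk≤-cons false (ascent a≤b)
ascent (B.b≤b {true} PW.∷ a≤b) = Walk≤-cons true (ascent a≤b)

weight-rise : ∀ {h} {a b : Word h} → a ≤ʷ b → weight b ≡ weight a + rise a b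
weight-rise PW.[] = refl
weight-rise {a = false ∷ a} {true ∷ b} (B.f≤t PW.∷ a≤b) =
  trans (cong suc (weight-rise a≤b)) (sym (+-suc (weight a) (rise a b)))
weight-rise (B.b≤b {false} PW.∷ a≤b) = weight-rise a≤b
weight-rise (B.b≤b {true} PW.∷ a≤b) = cong suc (weight-rise a≤b)

Walk≤⇒Walk : ∀ {h} {X : List (Word h)} {t a b : Word h} {n} → InG X t → Walk≤ t a b n → Walk X a b n
Walk≤⇒Walk tG (stop a≤t) = stop (Any.map (≤ʷ-trans a≤t) tG)
Walk≤⇒Walk tG (step a≤t a~b w) = step (Any.map (≤ʷ-trans a≤t) tG) a~b (Walk≤⇒Walk tG w)

junction-OnWalk : ∀ {h} {X : List (Word h)} {t a b c : Word h} {n m} (tG : InG X t)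
  (w : Walk≤ t a b n) (w′ : Walk≤ t b c m) → OnWalk b (Walk≤⇒Walk tG (w ++≤ w′))
junction-OnWalk tG (stop _) (stop _) = on-stop _
junction-OnWalk tG (stop _) (step _ b~b′ _) = on-here _ b~b′ _
junction-OnWalk tG (step _ a~a′ w) w′ = on-there _ a~a′ _ (junction-OnWalk tG w w′)

-- Climbing from 0ʰ to x through z takes weight x steps, the least any walk can take.
below⇒Interval : ∀ {h} (X : List (Word h)) {x z : Word h} → x ∈ X → z ≤ʷ x → Interval X (0ʰ h) x z
below⇒Interval {h} X {x} {z} x∈X z≤x =
  rise (0ʰ h) z + rise z x , Walk≤⇒Walk xG climb , shortest , junction-OnWalk xG up-to-z up-to-x
  where
  xG : InG X x
  xG = lose x∈X ≤ʷ-refl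
  up-to-z : Walk≤ x (0ʰ h) z (rise (0ʰ h) z)
  up-to-z = Walk≤-weaken z≤x (ascent (0ʰ≤ʷ z))
  up-to-x : Walk≤ x z x (rise z x)
  up-to-x = ascent z≤x
  climb : Walk≤ x (0ʰ h) x (rise (0ʰ h) z + rise z x)
  climb = up-to-z ++≤ up-to-x
  weight-x : weight x ≡ rise (0ʰ h) z + rise z x
  weight-x = begin
    weight x                                           ≡⟨ weight-rise z≤x ⟩
    weight z + rise z x                                ≡⟨ cong (_+ rise z x) (weight-rise (0ʰ≤ʷ z)) ⟩
    weight (0ʰ h) + rise (0ʰ h) z + rise z x           ≡⟨ cong (λ k → k + rise (0ʰ h) z + rise z x) (weight-0ʰ h) ⟩
    rise (0ʰ h) z + rise z x                           ∎
    where open ≡-Reasoning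
  shortest : ∀ m → Walk X (0ʰ h) x m → rise (0ʰ h) z + rise z x ≤ m
  shortest m w = subst (_≤ m) weight-x (subst (λ k → weight x ≤ k + m) (weight-0ʰ h) (walk-weight w))

Adj⇒upper-bound : ∀ {h} {X : List (Word h)} {u v : Word h} → InG X u → InG X v → Adj u v →
  ∃ λ w → InG X w × u ≤ʷ w × v ≤ʷ w
Adj⇒upper-bound {u = u} {v} uG vG u~v with Adj⇒comparable u v u~v
... | inj₁ u≤v = v , vG , u≤v , ≤ʷ-refl
... | inj₂ v≤u = u , uG , ≤ʷ-refl , v≤u

proposition5 : (h : ℕ) (X : List (Word h)) (u : Word h) →
    InG X u → degree X u ≡ h →
    ∀ v → InG X v → Adj u v → InGu X u v
proposition5 h X u uG _ v vG u~v =
  let w , wG , u≤w , v≤w = Adj⇒upper-bound uG vG u~v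
      x , x-max@(x∈X , _) , w≤x = below-maximal X wG
  in x , (x-max , below⇒Interval X x∈X (≤ʷ-trans u≤w w≤x)) , below⇒Interval X x∈X (≤ʷ-trans v≤w w≤x)
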